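{- Let $n\ge3$ and $1\le i\le n-1$. Then $\mathcal J_{i,1}\lessdot\mathcal J_{i,2}\lessdot\cdots\lessdot\mathcal J_{i,n-1}$ is a saturated chain in $\mathrm{MTub}(C_n)$.
   Context: A tube of a graph on $[n]$ is a nonempty vertex set inducing a connected subgraph; tubes $X,Y$ are compatible if $X\subseteq Y$, $Y\subseteq X$, or $X\cup Y$ is not a tube; a maximal tubing is an inclusion-maximal set of pairwise compatible tubes. For a maximal tubing $\mathcal T$ and $x\in[n]$, $\mathcal T_\downarrow(x)$ is the smallest tube of $\mathcal T$ containing $x$, and $\mathrm{top}_{\mathcal T}(T)$ is the unique $x$ with $\mathcal T_\downarrow(x)=T$. $\mathrm{MTub}(G)$ is the poset on maximal tubings generated by covers $\mathcal T\lessdot\mathcal J$ when $\mathcal T\setminus\{T\}=\mathcal J\setminus\{J\}$ with $\mathrm{top}_{\mathcal T}(T)<\mathrm{top}_{\mathcal J}(J)$. The $G$-tree of $\mathcal T$ is the order $x\le_{\mathcal T}y$ iff $x\in\mathcal T_\downarrow(y)$; a maximal tubing is determined by its $G$-tree. $C_n$ is the cycle with edges $\{i,i+1\}$ and $\{n,1\}$. For $1\le i,k\le n-1$, $\mathcal J_{i,k}$ is the maximal tubing of $C_n$ whose $G$-tree is the poset $j_{i,k}$ on $[n]$ with cover relations: if $1\le k\le n-i-1$: the chain $i\lessdot i+k+1\lessdot\cdots\lessdot n$, the chain $i+1\lessdot\cdots\lessdot i+k\lessdot i$, and the chain $1\lessdot\cdots\lessdot i-1\lessdot i$ (omitted if $i=1$);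 if $n-i\le k\le n-1$: the chain $n\lessdot n-k\lessdot n-k+1\lessdot\cdots\lessdot i$, the chain $i+1\lessdot\cdots\lessdot n-1\lessdot n$, and the chain $1\lessdot\cdots\lessdot n-k-1\lessdot n$ (omitted if $k=n-1$). -}

module Defs where

open import Level using (0ℓ)
open import Data.Nat using (ℕ; zero; suc; _+_; _∸_; _≤_; _<_)
open import Data.Fin using (Fin; toℕ)
open import Data.Fin.Subset using (Subset; _∈_; _⊆_; _∪_)
open import Data.Product using (Σ; ∃; _×_; _,_)
open import Data.Sum using (_⊎_)
open import Relation.Nullary using (¬_)
open import Relation.Binary.PropositionalEquality using (_≡_; _≢_)
open import Relation.Binary.Construct.Closure.ReflexiveTransitive using (Star)

-- A (simple, undirected) graph on the vertex set Fin n, given by its adjacency relation.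
-- Vertex  a : Fin n  is identified with the label  1 + toℕ a  ∈ [n].
Graph : ℕ → Set₁
Graph n = Fin n → Fin n → Set

lab : ∀ {n} → Fin n → ℕ
lab a = suc (toℕ a)

InEdge : ∀ {n} → Graph n → Subset n → Fin n → Fin n → Set
InEdge G X u v = u ∈ X × v ∈ X × G u v

IsTube : ∀ {n} → Graph n → Subset n → Set
IsTube G X = (∃ λ x → x ∈ X) × (∀ u v → u ∈ X → v ∈ X → Star (InEdge G X) u v)

Compatible : ∀ {n} → Graph n → Subset n → Subset n → Set
Compatible G X Y = X ⊆ Y ⊎ Y ⊆ X ⊎ ¬ IsTube G (X ∪ Y)

Family : ℕ → Set₁
Family n = Subset n → Set

IsTubing : ∀ {n} → Graph n → Family n → Set
IsTubing G 𝒯 = (∀ X → 𝒯 X → IsTube G X)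
             × (∀ X Y → 𝒯 X → 𝒯 Y → Compatible G X Y)

IsMaxTubing : ∀ {n} → Graph n → Family n → Set₁
IsMaxTubing G 𝒯 = IsTubing G 𝒯
                × (∀ (𝒮 : Family _) → (∀ X → 𝒯 X → 𝒮 X) → IsTubing G 𝒮 → ∀ X → 𝒮 X → 𝒯 X)

-- T is the smallest tube of 𝒯 containing x, i.e. 𝒯↓(x) = T
-- (equivalently, top_𝒯(T) = x)
IsDown : ∀ {n} → Family n → Fin n → Subset n → Set
IsDown 𝒯 x T = 𝒯 T × x ∈ T × (∀ T′ → 𝒯 T′ → x ∈ T′ → T ⊆ T′)

-- the cover relation of MTub(G):  𝒯 ⋖ 𝒥  iff both are maximal tubings and
-- 𝒯 ∖ {T} = 𝒥 ∖ {J} for some T ∈ 𝒯, J ∈ 𝒥 with top_𝒯(T) < top_𝒥(J)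
MTubCover : ∀ {n} → Graph n → Family n → Family n → Set₁
MTubCover {n} G 𝒯 𝒥 =
  IsMaxTubing G 𝒯 × IsMaxTubing G 𝒥 ×
  Σ (Subset n) λ T → Σ (Subset n) λ J → Σ (Fin n) λ x → Σ (Fin n) λ y →
    𝒯 T × 𝒥 J ×
    (∀ X → ((𝒯 X × X ≢ T) → (𝒥 X × X ≢ J)) × ((𝒥 X × X ≢ J) → (𝒯 X × X ≢ T))) ×
    IsDown 𝒯 x T × IsDown 𝒥 y J × lab x < lab y

data CEdge (n : ℕ) : ℕ → ℕ → Set where
  step : ∀ {a} → CEdge n a (suc a)
  wrap : CEdge n n 1

Cycle : (n : ℕ) → Graph n
Cycle n a b = CEdge n (lab a) (lab b) ⊎ CEdge n (lab b) (lab a)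

data JCov (n i k : ℕ) : ℕ → ℕ → Set where
  -- case 1 ≤ k ≤ n-i-1
  -- chain i ⋖ i+k+1 ⋖ ⋯ ⋖ n
  a1 : k ≤ n ∸ i ∸ 1 → JCov n i k i (i + k + 1)
  a2 : ∀ {a} → k ≤ n ∸ i ∸ 1 → i + k + 1 ≤ a → suc a ≤ n → JCov n i k a (suc a)
  -- chain i+1 ⋖ ⋯ ⋖ i+k ⋖ i
  a3 : ∀ {a} → k ≤ n ∸ i ∸ 1 → i + 1 ≤ a → suc a ≤ i + k → JCov n i k a (suc a)
  a4 : k ≤ n ∸ i ∸ 1 → JCov n i k (i + k) i
  -- chain 1 ⋖ ⋯ ⋖ i-1 ⋖ i   (empty if i = 1)
  a5 : ∀ {a} → k ≤ n ∸ i ∸ 1 → 1 ≤ a → suc a ≤ i → JCov n i k a (suc a)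
  -- case n-i ≤ k ≤ n-1
  -- chain n ⋖ n-k ⋖ n-k+1 ⋖ ⋯ ⋖ i
  b1 : n ∸ i ≤ k → JCov n i k n (n ∸ k)
  b2 : ∀ {a} → n ∸ i ≤ k → n ∸ k ≤ a → suc a ≤ i → JCov n i k a (suc a)
  -- chain i+1 ⋖ ⋯ ⋖ n-1 ⋖ n
  b3 : ∀ {a} → n ∸ i ≤ k → i + 1 ≤ a → suc a ≤ n → JCov n i k a (suc a)
  -- chain 1 ⋖ ⋯ ⋖ n-k-1 ⋖ n   (empty if k = n-1)
  b4 : ∀ {a} → n ∸ i ≤ k → 1 ≤ a → suc a ≤ n ∸ k ∸ 1 → JCov n i k a (suc a)
  b5 : n ∸ i ≤ k → 1 ≤ n ∸ k ∸ 1 → JCov n i k (n ∸ k ∸ 1) n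

JLe : (n i k : ℕ) → Fin n → Fin n → Set
JLe n i k = Star (λ a b → JCov n i k (lab a) (lab b))

-- 𝒥_{i,k}: the tubing whose G-tree is j_{i,k}; its tubes are the principal
-- down-sets  {x | x ≤ y}  of j_{i,k}  (𝒥↓(y) = {x | x ≤_𝒥 y})
𝒥 : (n i k : ℕ) → Family n
𝒥 n i k X = ∃ λ (y : Fin n) → ∀ (x : Fin n) → (x ∈ X → JLe n i k x y) × (JLe n i k x y → x ∈ X)

{-# OPTIONS --safe #-}
module Submission where

open import Defs
open import Level using (0ℓ)
open import Data.Nat
  using (ℕ; zero; suc; _+_; _∸_; _≤_; _<_; _≤′_; ≤′-refl; ≤′-step; z≤n; s≤s; _≟_; _≤?_)
open import Data.Nat.Properties
open import Data.Nat.Induction using (<-wellFounded)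
open import Induction.WellFounded using (Acc; acc)
open import Data.Fin using (Fin; fromℕ<) renaming (zero to fzero; suc to fsuc)
open import Data.Fin.Properties using (any?; toℕ-injective; toℕ-fromℕ<; toℕ<n) renaming (_≟_ to _≟ᶠ_)
open import Data.Fin.Subset using (Subset; _∈_; _∉_; _⊆_; _∪_)
open import Data.Fin.Subset.Properties using (x∈p∪q⁻; x∈p∪q⁺; _∈?_; ⊆-antisym)
open import Data.Vec using (tabulate)
open import Data.Vec.Properties using ([]=⇒lookup; lookup⇒[]=; lookup∘tabulate)
open import Data.Product using (∃; ∃₂; _×_; _,_; proj₁; proj₂; swap)
open import Data.Sum using (_⊎_; inj₁; inj₂; [_,_]′) renaming (map to ⊎-map; swap to ⊎-swap)
open import Data.Empty using (⊥-elim)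
open import Function using (_∘_; id; _⇔_; mk⇔; Equivalence)
import Function.Properties.Equivalence as ⇔
open import Relation.Nullary using (¬_; Dec; yes; no; does)
open import Relation.Nullary.Decidable using (dec-true; map′)
open import Relation.Unary using (Pred; Decidable)
open import Relation.Binary.Definitions using (tri<; tri≈; tri>)
open import Relation.Binary.PropositionalEquality
  using (_≡_; _≢_; refl; sym; trans; cong; subst; subst₂; module ≡-Reasoning)
open import Relation.Binary.Construct.Closure.ReflexiveTransitive using (Star; ε; _◅_; _◅◅_; gmap; reverse)

-- The principal down-sets of a G-tree (a rooted forest on the vertices in which adjacent
-- vertices are comparable and every principal down-set is connected) form a maximal tubing.
-- Passing from j_{i,k} to j_{i,k+1} rotates one edge t ⋖ s: s becomes the parent of t, t takes
-- over the parent of s, and some children of t move to s. The rotation turns the down-set of s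
-- into that of t and fixes every other down-set except the old ↓t and the new ↓s, so the two
-- tubings differ in exactly one tube, with tops t < s. The rotated edge is (i, i+k+1) while
-- i+k+1 < n, then (i, n), and (n-k-1, n) once k ≥ n-i.

subsetOf : ∀ {n} {P : Pred (Fin n) 0ℓ} → Decidable P → Subset n
subsetOf P? = tabulate (does ∘ P?)

∈-subsetOf⁺ : ∀ {n} {P : Pred (Fin n) 0ℓ} (P? : Decidable P) {x} → P x → x ∈ subsetOf P?
∈-subsetOf⁺ P? {x} p = lookup⇒[]= x _ (trans (lookup∘tabulate (does ∘ P?) x) (dec-true (P? x) p))

∈-subsetOf⁻ : ∀ {n} {P : Pred (Fin n) 0ℓ} (P? : Decidable P) {x} → x ∈ subsetOf P? → P x
∈-subsetOf⁻ P? {x} x∈ with P? x | trans (sym (lookup∘tabulate (does ∘ P?) x)) ([]=⇒lookup x∈)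
... | yes p | _ = p
... | no _ | ()

argmax : ∀ {n} (f : Fin n → ℕ) {P : Pred (Fin n) 0ℓ} → Decidable P → ∃ P →
         ∃ λ y → P y × (∀ x → P x → f x ≤ f y)
argmax {zero} f P? (() , _)
argmax {suc n} f P? (x , px) with any? (P? ∘ fsuc)
argmax {suc n} f P? (fzero , p0) | no none =
  fzero , p0 , λ { fzero _ → ≤-refl ; (fsuc x) px → ⊥-elim (none (x , px)) }
argmax {suc n} f P? (fsuc x , px) | no none = ⊥-elim (none (x , px))
argmax {suc n} f P? _ | yes inTail with argmax (f ∘ fsuc) (P? ∘ fsuc) inTail | P? fzero
... | y , py , max | no ¬p0 = fsuc y , py , λ { fzero p0 → ⊥-elim (¬p0 p0) ; (fsuc x) px → max x px }
... | y , py , max | yes p0 with ≤-total (f fzero) (f (fsuc y))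
...   | inj₁ f0≤ = fsuc y , py , λ { fzero _ → f0≤ ; (fsuc x) px → max x px }
...   | inj₂ ≤f0 = fzero , p0 , λ { fzero _ → ≤-refl ; (fsuc x) px → ≤-trans (max x px) ≤f0 }

exit-edge : ∀ {A : Set} {R : A → A → Set} {P : Pred A 0ℓ} → Decidable P →
            ∀ {a b} → Star R a b → P a → ¬ P b → ∃₂ λ c d → R c d × P c × ¬ P d
exit-edge P? ε pa ¬pb = ⊥-elim (¬pb pa)
exit-edge P? (_◅_ {j = c} r rs) pa ¬pb with P? c
... | yes pc = exit-edge P? rs pc ¬pb
... | no ¬pc = _ , _ , r , pa , ¬pc

ascending-chain : ∀ {R : ℕ → ℕ → Set} {lo hi} → (∀ {a} → lo ≤ a → suc a ≤ hi → R a (suc a)) →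
                  ∀ {a b} → lo ≤ a → a ≤ b → b ≤ hi → Star R a b
ascending-chain {R} {lo} {hi} next {a} lo≤a a≤b = go (≤⇒≤′ a≤b)
  where
  go : ∀ {b} → a ≤′ b → b ≤ hi → Star R a b
  go ≤′-refl _ = ε
  go (≤′-step a≤′b) b<hi = go a≤′b (<⇒≤ b<hi) ◅◅ next (≤-trans lo≤a (≤′⇒≤ a≤′b)) b<hi ◅ ε

m∸1<m : ∀ {m} → 1 ≤ m → m ∸ 1 < m
m∸1<m {suc m} _ = ≤-refl

suc[m∸1]≡m : ∀ {m} → 1 ≤ m → suc (m ∸ 1) ≡ m
suc[m∸1]≡m {suc m} _ = refl

-- Tubings from G-trees

module Paths {n} (G : Graph n) (G-sym : ∀ {u v} → G u v → G v u) where

  Path : Subset n → Fin n → Fin n → Set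
  Path X = Star (InEdge G X)

  path-mono : ∀ {X Y} → X ⊆ Y → ∀ {u v} → Path X u v → Path Y u v
  path-mono X⊆Y = gmap id λ (u∈ , v∈ , uv) → X⊆Y u∈ , X⊆Y v∈ , uv

  path-reverse : ∀ {X u v} → Path X u v → Path X v u
  path-reverse = reverse λ (u∈ , v∈ , uv) → v∈ , u∈ , G-sym uv

  ∪-isTube : ∀ {X Y u v} → IsTube G X → IsTube G Y → u ∈ X → v ∈ Y → G u v → IsTube G (X ∪ Y)
  ∪-isTube {X} {Y} {u} {v} ((x , x∈X) , X-conn) (_ , Y-conn) u∈X v∈Y uv =
    (x , X⊆ x∈X) , λ a b a∈ b∈ → path (x∈p∪q⁻ X Y a∈) (x∈p∪q⁻ X Y b∈)
    where
    X⊆ : X ⊆ X ∪ Y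
    X⊆ m = x∈p∪q⁺ (inj₁ m)
    Y⊆ : Y ⊆ X ∪ Y
    Y⊆ m = x∈p∪q⁺ (inj₂ m)
    across : ∀ {a b} → a ∈ X → b ∈ Y → Path (X ∪ Y) a b
    across a∈ b∈ =
      path-mono X⊆ (X-conn _ _ a∈ u∈X) ◅◅ (X⊆ u∈X , Y⊆ v∈Y , uv) ◅ path-mono Y⊆ (Y-conn _ _ v∈Y b∈)
    path : ∀ {a b} → a ∈ X ⊎ a ∈ Y → b ∈ X ⊎ b ∈ Y → Path (X ∪ Y) a b
    path (inj₁ a∈) (inj₁ b∈) = path-mono X⊆ (X-conn _ _ a∈ b∈)
    path (inj₂ a∈) (inj₂ b∈) = path-mono Y⊆ (Y-conn _ _ a∈ b∈)
    path (inj₁ a∈) (inj₂ b∈) = across a∈ b∈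
    path (inj₂ a∈) (inj₁ b∈) = path-reverse (across b∈ a∈)

-- `rank` makes the forest well founded; `subtree-adjacent` makes every principal down-set connected.
record GTree {n} (G : Graph n) : Set₁ where
  field
    _⋖_ : Fin n → Fin n → Set
    ⋖-functional : ∀ {x y z} → x ⋖ y → x ⋖ z → y ≡ z
    rank : Fin n → ℕ
    ⋖-rank : ∀ {x y} → x ⋖ y → rank x < rank y
    _⋖?_ : ∀ x y → Dec (x ⋖ y)
    edge-comparable : ∀ {u v} → G u v → Star _⋖_ u v ⊎ Star _⋖_ v u
    subtree-adjacent : ∀ {c y} → c ⋖ y → ∃ λ z → Star _⋖_ z c × G z y

  _≼_ : Fin n → Fin n → Set
  _≼_ = Star _⋖_

module GTreeOrder {n} {G : Graph n} (T : GTree G) where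
  open GTree T

  ⋖-irrefl : ∀ {x} → ¬ x ⋖ x
  ⋖-irrefl x⋖x = <-irrefl refl (⋖-rank x⋖x)

  ≼-rank : ∀ {x y} → x ≼ y → x ≡ y ⊎ rank x < rank y
  ≼-rank ε = inj₁ refl
  ≼-rank (x⋖ ◅ p) with ≼-rank p
  ... | inj₁ refl = inj₂ (⋖-rank x⋖)
  ... | inj₂ lt = inj₂ (<-trans (⋖-rank x⋖) lt)

  ≼-antisym : ∀ {x y} → x ≼ y → y ≼ x → x ≡ y
  ≼-antisym p q with ≼-rank p | ≼-rank q
  ... | inj₁ x≡y | _ = x≡y
  ... | inj₂ _ | inj₁ y≡x = sym y≡x
  ... | inj₂ x<y | inj₂ y<x = ⊥-elim (<-asym x<y y<x)

  ≼-upward-total : ∀ {x y z} → x ≼ y → x ≼ z → y ≼ z ⊎ z ≼ y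
  ≼-upward-total ε q = inj₁ q
  ≼-upward-total p@(_ ◅ _) ε = inj₂ p
  ≼-upward-total (x⋖ ◅ p) (x⋖′ ◅ q) with ⋖-functional x⋖ x⋖′
  ... | refl = ≼-upward-total p q

  ≼-unsnoc : ∀ {x y} → x ≼ y → x ≡ y ⊎ ∃ λ c → x ≼ c × c ⋖ y
  ≼-unsnoc ε = inj₁ refl
  ≼-unsnoc (x⋖ ◅ p) with ≼-unsnoc p
  ... | inj₁ refl = inj₂ (_ , ε , x⋖)
  ... | inj₂ (c , q , c⋖) = inj₂ (c , x⋖ ◅ q , c⋖)

  _≼?_ : ∀ x y → Dec (x ≼ y)
  x ≼? y = go y (<-wellFounded (rank y))
    where
    go : ∀ y → Acc _<_ (rank y) → Dec (x ≼ y)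
    go y (acc rec) with x ≟ᶠ y
    ... | yes refl = yes ε
    ... | no x≢y = map′ (λ (c , c⋖y , x≼c) → x≼c ◅◅ c⋖y ◅ ε) last-step (any? below)
      where
      below : ∀ c → Dec (c ⋖ y × x ≼ c)
      below c with c ⋖? y
      ... | no c⋖̸y = no (c⋖̸y ∘ proj₁)
      ... | yes c⋖y = map′ (c⋖y ,_) proj₂ (go c (rec (⋖-rank c⋖y)))
      last-step : x ≼ y → ∃ λ c → c ⋖ y × x ≼ c
      last-step x≼y = [ ⊥-elim ∘ x≢y , (λ (c , x≼c , c⋖y) → c , c⋖y , x≼c) ]′ (≼-unsnoc x≼y)

  IsDownSet : Subset n → Fin n → Set
  IsDownSet X y = ∀ x → (x ∈ X → x ≼ y) × (x ≼ y → x ∈ X)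

  downSets : Family n
  downSets X = ∃ (IsDownSet X)

  ↓ : Fin n → Subset n
  ↓ y = subsetOf (_≼? y)

  ∈↓⁺ : ∀ {x y} → x ≼ y → x ∈ ↓ y
  ∈↓⁺ {y = y} = ∈-subsetOf⁺ (_≼? y)

  ∈↓⁻ : ∀ {x y} → x ∈ ↓ y → x ≼ y
  ∈↓⁻ {y = y} = ∈-subsetOf⁻ (_≼? y)

  ↓-isDownSet : ∀ y → IsDownSet (↓ y) y
  ↓-isDownSet y x = ∈↓⁻ , ∈↓⁺

  ↓-unique : ∀ {X y} → IsDownSet X y → X ≡ ↓ y
  ↓-unique hX = ⊆-antisym (λ {x} x∈ → ∈↓⁺ (proj₁ (hX x) x∈)) (λ {x} x∈ → proj₂ (hX x) (∈↓⁻ x∈))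

  ↓-mono : ∀ {x y} → x ≼ y → ↓ x ⊆ ↓ y
  ↓-mono x≼y w∈ = ∈↓⁺ (∈↓⁻ w∈ ◅◅ x≼y)

  ↓-injective : ∀ {x y} → ↓ x ≡ ↓ y → x ≡ y
  ↓-injective {x} {y} ↓x≡↓y =
    ≼-antisym (∈↓⁻ (subst (x ∈_) ↓x≡↓y (∈↓⁺ ε))) (∈↓⁻ (subst (y ∈_) (sym ↓x≡↓y) (∈↓⁺ ε)))

  ↓-isDown : ∀ x → IsDown downSets x (↓ x)
  ↓-isDown x = (x , ↓-isDownSet x) , ∈↓⁺ ε ,
    λ X (y , hX) x∈X {w} w∈ → proj₂ (hX w) (∈↓⁻ w∈ ◅◅ proj₁ (hX x) x∈X)

module GTreeTubing {n} {G : Graph n} (G-sym : ∀ {u v} → G u v → G v u) (T : GTree G) where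
  open GTree T
  open GTreeOrder T
  open Paths G G-sym

  ↓-path : ∀ {x y} → x ≼ y → Path (↓ y) x y
  ↓-path {y = y} = go y (<-wellFounded (rank y))
    where
    go : ∀ y → Acc _<_ (rank y) → ∀ {x} → x ≼ y → Path (↓ y) x y
    go y (acc rec) x≼y with ≼-unsnoc x≼y
    ... | inj₁ refl = ε
    ... | inj₂ (c , x≼c , c⋖y) with subtree-adjacent c⋖y
    ...   | z , z≼c , zy =
      path-mono (↓-mono (c⋖y ◅ ε))
                (go c (rec (⋖-rank c⋖y)) x≼c ◅◅ path-reverse (go c (rec (⋖-rank c⋖y)) z≼c))
        ◅◅ (∈↓⁺ (z≼c ◅◅ c⋖y ◅ ε) , ∈↓⁺ ε , zy) ◅ ε

  ↓-isTube : ∀ y → IsTube G (↓ y)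
  ↓-isTube y = (y , ∈↓⁺ ε) , λ u v u∈ v∈ → ↓-path (∈↓⁻ u∈) ◅◅ path-reverse (↓-path (∈↓⁻ v∈))

  ↓-compatible : ∀ y z → Compatible G (↓ y) (↓ z)
  ↓-compatible y z with y ≼? z | z ≼? y
  ... | yes y≼z | _ = inj₁ (↓-mono y≼z)
  ... | no _ | yes z≼y = inj₂ (inj₁ (↓-mono z≼y))
  ... | no y⋠z | no z⋠y = inj₂ (inj₂ λ (_ , conn) →
          no-exit (exit-edge (_∈? ↓ y) (conn y z (x∈p∪q⁺ (inj₁ (∈↓⁺ ε))) (x∈p∪q⁺ (inj₂ (∈↓⁺ ε))))
                             (∈↓⁺ ε) (z⋠y ∘ ∈↓⁻)))
    where
    no-exit : ¬ ∃₂ λ c d → InEdge G (↓ y ∪ ↓ z) c d × c ∈ ↓ y × d ∉ ↓ y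
    no-exit (c , d , (_ , d∈ , cd) , c∈↓y , d∉↓y) with x∈p∪q⁻ (↓ y) (↓ z) d∈ | edge-comparable cd
    ... | inj₁ d∈↓y | _ = d∉↓y d∈↓y
    ... | inj₂ _ | inj₂ d≼c = d∉↓y (∈↓⁺ (d≼c ◅◅ ∈↓⁻ c∈↓y))
    ... | inj₂ d∈↓z | inj₁ c≼d with ≼-upward-total (∈↓⁻ c∈↓y) (c≼d ◅◅ ∈↓⁻ d∈↓z)
    ...   | inj₁ y≼z = y⋠z y≼z
    ...   | inj₂ z≼y = z⋠y z≼y

  downSets-isTubing : IsTubing G downSets
  downSets-isTubing = tubes , compatible
    where
    tubes : ∀ X → downSets X → IsTube G X
    tubes X (y , hX) with ↓-unique hX
    ... | refl = ↓-isTube y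
    compatible : ∀ X Y → downSets X → downSets Y → Compatible G X Y
    compatible X Y (y , hX) (z , hY) with ↓-unique hX | ↓-unique hY
    ... | refl | refl = ↓-compatible y z

  -- A tube compatible with every ↓a is the down-set of its element of largest rank.
  downSets-maximal : ∀ (𝒮 : Family n) → (∀ X → downSets X → 𝒮 X) → IsTubing G 𝒮 →
                     ∀ X → 𝒮 X → downSets X
  downSets-maximal 𝒮 downSets⊆𝒮 (tubes , compatible) X X∈𝒮 with tubes X X∈𝒮
  ... | X-tube with argmax rank (_∈? X) (proj₁ X-tube)
  ...   | y , y∈X , y-max = y , λ x → below-y x , ↓y⊆X
    where
    y-maximal : ∀ {v} → v ∈ X → y ≼ v → v ≡ y
    y-maximal v∈X y≼v with ≼-rank y≼v
    ... | inj₁ y≡v = sym y≡v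
    ... | inj₂ y<v = ⊥-elim (<⇒≱ y<v (y-max _ v∈X))

    climb : ∀ {a b} → Path X a b → a ≼ y → b ≼ y
    climb ε a≼y = a≼y
    climb ((_ , b∈X , ab) ◅ p) a≼y with edge-comparable ab
    ... | inj₂ b≼a = climb p (b≼a ◅◅ a≼y)
    ... | inj₁ a≼b with ≼-upward-total a≼y a≼b
    ...   | inj₂ b≼y = climb p b≼y
    ...   | inj₁ y≼b with y-maximal b∈X y≼b
    ...     | refl = climb p ε

    below-y : ∀ x → x ∈ X → x ≼ y
    below-y x x∈X = climb (proj₂ X-tube y x y∈X x∈X) ε

    descend : ∀ {a} → Path (↓ y) a y → a ∈ X
    descend ε = y∈X
    descend {a} ((a∈↓y , _ , ab) ◅ p) with a ∈? X
    ... | yes a∈X = a∈X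
    ... | no a∉X with compatible X (↓ a) X∈𝒮 (downSets⊆𝒮 (↓ a) (a , ↓-isDownSet a))
    ...   | inj₁ X⊆↓a =
            ⊥-elim (a∉X (subst (_∈ X) (≼-antisym (∈↓⁻ (X⊆↓a y∈X)) (∈↓⁻ a∈↓y)) y∈X))
    ...   | inj₂ (inj₁ ↓a⊆X) = ⊥-elim (a∉X (↓a⊆X (∈↓⁺ ε)))
    ...   | inj₂ (inj₂ ¬tube) =
            ⊥-elim (¬tube (∪-isTube X-tube (↓-isTube a) (descend p) (∈↓⁺ ε) (G-sym ab)))

    ↓y⊆X : ∀ {x} → x ≼ y → x ∈ X
    ↓y⊆X x≼y = descend (↓-path x≼y)

  downSets-isMaxTubing : IsMaxTubing G downSets
  downSets-isMaxTubing = downSets-isTubing , downSets-maximal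

-- Rotations

module _ {n} {G : Graph n} (A B : GTree G) where
  open GTree A using () renaming (_⋖_ to _⋖ᴬ_)
  open GTree B using () renaming (_⋖_ to _⋖ᴮ_)

  record IsRotation (t s : Fin n) : Set where
    field
      t⋖s : t ⋖ᴬ s
      s⋖t : s ⋖ᴮ t
      parent-swap : ∀ v → s ⋖ᴬ v ⇔ t ⋖ᴮ v
      others : ∀ u → u ≢ t → u ≢ s → (∀ v → u ⋖ᴬ v ⇔ u ⋖ᴮ v) ⊎ (u ⋖ᴬ t × u ⋖ᴮ s)

IsRotation-reverse : ∀ {n} {G : Graph n} {A B : GTree G} {t s} → IsRotation A B t s → IsRotation B A s t
IsRotation-reverse ρ = record
  { t⋖s = s⋖t
  ; s⋖t = t⋖s
  ; parent-swap = ⇔.sym ∘ parent-swap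
  ; others = λ u u≢s u≢t → ⊎-map (⇔.sym ∘_) swap (others u u≢t u≢s)
  }
  where open IsRotation ρ

module Transport {n} {G : Graph n} {A B : GTree G} {t s} (ρ : IsRotation A B t s) where
  open IsRotation ρ
  open GTree A using () renaming (_⋖_ to _⋖ᴬ_; _≼_ to _≼ᴬ_; ⋖-functional to ⋖ᴬ-functional)
  open GTree B using () renaming (_⋖_ to _⋖ᴮ_; _≼_ to _≼ᴮ_; ⋖-functional to ⋖ᴮ-functional)

  t≢s : t ≢ s
  t≢s refl = GTreeOrder.⋖-irrefl A t⋖s

  -- y′ is the vertex whose B-down-set is the A-down-set of y
  data Corresponds : Fin n → Fin n → Set where
    moved : Corresponds s t
    fixed : ∀ {y} → y ≢ t → y ≢ s → Corresponds y y

  correspondent : ∀ {y} → y ≢ t → ∃ (Corresponds y)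
  correspondent {y} y≢t with y ≟ᶠ s
  ... | yes refl = t , moved
  ... | no y≢s = y , fixed y≢t y≢s

  correspondent-≢ : ∀ {y y′} → Corresponds y y′ → y′ ≢ s
  correspondent-≢ moved = t≢s
  correspondent-≢ (fixed _ y≢s) = y≢s

  ≼ᴮ-past-s : ∀ {w} → s ≼ᴮ w → w ≢ s → t ≼ᴮ w
  ≼ᴮ-past-s ε w≢s = ⊥-elim (w≢s refl)
  ≼ᴮ-past-s (s⋖ ◅ p) _ with ⋖ᴮ-functional s⋖ s⋖t
  ... | refl = p

  ≼-transport : ∀ {x y y′} → Corresponds y y′ → x ≼ᴬ y → x ≼ᴮ y′
  ≼-transport moved ε = s⋖t ◅ ε
  ≼-transport (fixed _ _) ε = ε
  ≼-transport {x} c (x⋖ ◅ p) with x ≟ᶠ t | x ≟ᶠ s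
  ... | yes refl | _ with ⋖ᴬ-functional x⋖ t⋖s
  ...   | refl = ≼ᴮ-past-s (≼-transport c p) (correspondent-≢ c)
  ≼-transport c (x⋖ ◅ p) | no _ | yes refl = s⋖t ◅ Equivalence.to (parent-swap _) x⋖ ◅ ≼-transport c p
  ≼-transport {x} c (x⋖ ◅ p) | no x≢t | no x≢s with others x x≢t x≢s
  ... | inj₁ same = Equivalence.to (same _) x⋖ ◅ ≼-transport c p
  ... | inj₂ (x⋖ᴬt , x⋖ᴮs) with ⋖ᴬ-functional x⋖ x⋖ᴬt
  ...   | refl = x⋖ᴮs ◅ s⋖t ◅ ≼-transport c p

module Transfer {n} {G : Graph n} {A B : GTree G} {t s} (ρ : IsRotation A B t s) where
  private
    module A = GTreeOrder A
    module B = GTreeOrder B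
    module ⇒ = Transport ρ
    module ⇐ = Transport (IsRotation-reverse ρ)

  corresponds-reverse : ∀ {y y′} → ⇒.Corresponds y y′ → ⇐.Corresponds y′ y
  corresponds-reverse ⇒.moved = ⇐.moved
  corresponds-reverse (⇒.fixed y≢t y≢s) = ⇐.fixed y≢s y≢t

  downSet-transfer : ∀ X → A.downSets X × X ≢ A.↓ t → B.downSets X × X ≢ B.↓ s
  downSet-transfer X ((y , hX) , X≢↓t) = (y′ , hX′) , X≢↓s
    where
    y≢t : y ≢ t
    y≢t refl = X≢↓t (A.↓-unique hX)
    y′ : Fin n
    y′ = proj₁ (⇒.correspondent y≢t)
    y↦y′ : ⇒.Corresponds y y′
    y↦y′ = proj₂ (⇒.correspondent y≢t)
    hX′ : B.IsDownSet X y′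
    hX′ x = ⇒.≼-transport y↦y′ ∘ proj₁ (hX x) ,
            proj₂ (hX x) ∘ ⇐.≼-transport (corresponds-reverse y↦y′)
    X≢↓s : X ≢ B.↓ s
    X≢↓s X≡↓s = ⇒.correspondent-≢ y↦y′ (B.↓-injective (trans (sym (B.↓-unique hX′)) X≡↓s))

rotation-cover : ∀ {n} {G : Graph n} (G-sym : ∀ {u v} → G u v → G v u) {A B : GTree G} {t s} →
                 IsRotation A B t s → lab t < lab s →
                 MTubCover G (GTreeOrder.downSets A) (GTreeOrder.downSets B)
rotation-cover G-sym {A} {B} {t} {s} ρ t<s =
  GTreeTubing.downSets-isMaxTubing G-sym A , GTreeTubing.downSets-isMaxTubing G-sym B ,
  A.↓ t , B.↓ s , t , s , (t , A.↓-isDownSet t) , (s , B.↓-isDownSet s) ,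
  (λ X → Transfer.downSet-transfer ρ X , Transfer.downSet-transfer (IsRotation-reverse ρ) X) ,
  A.↓-isDown t , B.↓-isDown s , t<s
  where
  module A = GTreeOrder A
  module B = GTreeOrder B

-- G-trees of the cycle, on vertex labels

lab-injective : ∀ {n} {x y : Fin n} → lab x ≡ lab y → x ≡ y
lab-injective = toℕ-injective ∘ suc-injective

lab-surjective : ∀ {n a} → 1 ≤ a → a ≤ n → ∃ λ (x : Fin n) → lab x ≡ a
lab-surjective {a = suc a} _ a<n = fromℕ< a<n , cong suc (toℕ-fromℕ< a<n)

1≤lab : ∀ {n} (x : Fin n) → 1 ≤ lab x
1≤lab x = s≤s z≤n

lab≤n : ∀ {n} (x : Fin n) → lab x ≤ n
lab≤n = toℕ<n

Cycle-sym : ∀ {n} {u v : Fin n} → Cycle n u v → Cycle n v u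
Cycle-sym = ⊎-swap

CycleAdjacent : ℕ → ℕ → ℕ → Set
CycleAdjacent n a b = CEdge n a b ⊎ CEdge n b a

-- A G-tree of C_n on the labels 1..n. The cover relation is a field rather than being derived
-- from `parent`, so that the tubing of `toGTree` is definitionally 𝒥 n i k.
record CycleTree (n : ℕ) : Set₁ where
  field
    _⋖_ : ℕ → ℕ → Set
    root : ℕ
    parent : ℕ → ℕ
    ⋖-parent : ∀ {a b} → a ⋖ b → a ≢ root × b ≡ parent a × 1 ≤ b × b ≤ n
    parent-⋖ : ∀ {a} → 1 ≤ a → a ≤ n → a ≢ root → a ⋖ parent a
    rank : ℕ → ℕ
    rank-parent : ∀ {a} → a ≢ root → rank a < rank (parent a)
    suc-comparable : ∀ {a} → 1 ≤ a → suc a ≤ n → Star _⋖_ a (suc a) ⊎ Star _⋖_ (suc a) a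
    wrap-comparable : Star _⋖_ 1 n ⊎ Star _⋖_ n 1
    subtree-adjacent : ∀ {a} → 1 ≤ a → a ≤ n → a ≢ root →
                       ∃ λ z → 1 ≤ z × z ≤ n × Star _⋖_ z a × CycleAdjacent n z (parent a)

  ⋖-nonroot : ∀ {a b} → a ⋖ b → a ≢ root
  ⋖-nonroot a⋖b = proj₁ (⋖-parent a⋖b)

  ⋖-is-parent : ∀ {a b} → a ⋖ b → b ≡ parent a
  ⋖-is-parent a⋖b = proj₁ (proj₂ (⋖-parent a⋖b))

module _ {n} (T : CycleTree n) where
  open CycleTree T

  private
    _⋖ᶠ_ : Fin n → Fin n → Set
    x ⋖ᶠ y = lab x ⋖ lab y

    star-lift : ∀ {a b} → Star _⋖_ a b → ∀ {x y} → lab x ≡ a → lab y ≡ b → Star _⋖ᶠ_ x y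
    star-lift ε x≡ y≡ = subst (Star _⋖ᶠ_ _) (lab-injective (trans x≡ (sym y≡))) ε
    star-lift (a⋖c ◅ p) x≡ y≡ with proj₂ (proj₂ (⋖-parent a⋖c))
    ... | c-range with lab-surjective (proj₁ c-range) (proj₂ c-range)
    ...   | w , refl = subst (_⋖ _) (sym x≡) a⋖c ◅ star-lift p refl y≡

    ⋖ᶠ-functional : ∀ {x y z} → x ⋖ᶠ y → x ⋖ᶠ z → y ≡ z
    ⋖ᶠ-functional x⋖y x⋖z = lab-injective (trans (⋖-is-parent x⋖y) (sym (⋖-is-parent x⋖z)))

    ⋖ᶠ-rank : ∀ {x y} → x ⋖ᶠ y → rank (lab x) < rank (lab y)
    ⋖ᶠ-rank {x} x⋖y with ⋖-parent x⋖y
    ... | x≢root , y≡ , _ = subst (λ b → rank (lab x) < rank b) (sym y≡) (rank-parent x≢root)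

    _⋖ᶠ?_ : ∀ x y → Dec (x ⋖ᶠ y)
    x ⋖ᶠ? y with lab x ≟ root | lab y ≟ parent (lab x)
    ... | yes x≡root | _ = no λ x⋖y → ⋖-nonroot x⋖y x≡root
    ... | no x≢root | yes y≡ = yes (subst (lab x ⋖_) (sym y≡) (parent-⋖ (1≤lab x) (lab≤n x) x≢root))
    ... | no _ | no y≢ = no λ x⋖y → y≢ (⋖-is-parent x⋖y)

    lift : ∀ {x y} → Star _⋖_ (lab x) (lab y) → Star _⋖ᶠ_ x y
    lift p = star-lift p refl refl

    cedge-comparable : ∀ {a b} → 1 ≤ a → b ≤ n → CEdge n a b → Star _⋖_ a b ⊎ Star _⋖_ b a
    cedge-comparable 1≤a b≤n step = suc-comparable 1≤a b≤n
    cedge-comparable _ _ wrap = ⊎-swap wrap-comparable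

    ⋖ᶠ-edge-comparable : ∀ {u v} → Cycle n u v → Star _⋖ᶠ_ u v ⊎ Star _⋖ᶠ_ v u
    ⋖ᶠ-edge-comparable {u} {v} (inj₁ uv) = ⊎-map lift lift (cedge-comparable (1≤lab u) (lab≤n v) uv)
    ⋖ᶠ-edge-comparable {u} {v} (inj₂ vu) = ⊎-swap (⊎-map lift lift (cedge-comparable (1≤lab v) (lab≤n u) vu))

    ⋖ᶠ-subtree-adjacent : ∀ {c y} → c ⋖ᶠ y → ∃ λ z → Star _⋖ᶠ_ z c × Cycle n z y
    ⋖ᶠ-subtree-adjacent {c} c⋖y with ⋖-parent c⋖y
    ... | c≢root , y≡ , _ with subtree-adjacent (1≤lab c) (lab≤n c) c≢root
    ...   | z , 1≤z , z≤max , z≼c , adj with lab-surjective 1≤z z≤max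
    ...     | w , refl = w , lift z≼c , subst (CycleAdjacent n (lab w)) (sym y≡) adj

  toGTree : GTree (Cycle n)
  toGTree = record
    { _⋖_ = _⋖ᶠ_
    ; ⋖-functional = ⋖ᶠ-functional
    ; rank = rank ∘ lab
    ; ⋖-rank = ⋖ᶠ-rank
    ; _⋖?_ = _⋖ᶠ?_
    ; edge-comparable = ⋖ᶠ-edge-comparable
    ; subtree-adjacent = ⋖ᶠ-subtree-adjacent
    }

module _ {n} (A B : CycleTree n) where
  private
    module A = CycleTree A
    module B = CycleTree B

  SameParent : ℕ → ℕ → Set
  SameParent a a′ = (a ≡ A.root × a′ ≡ B.root) ⊎ (a ≢ A.root × a′ ≢ B.root × A.parent a ≡ B.parent a′)

  sameParent-⋖ : ∀ {a a′} → 1 ≤ a → a ≤ n → 1 ≤ a′ → a′ ≤ n → SameParent a a′ →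
                 ∀ b → a A.⋖ b ⇔ a′ B.⋖ b
  sameParent-⋖ _ _ _ _ (inj₁ (a≡root , a′≡root)) b =
    mk⇔ (λ a⋖b → ⊥-elim (A.⋖-nonroot a⋖b a≡root))
        (λ a′⋖b → ⊥-elim (B.⋖-nonroot a′⋖b a′≡root))
  sameParent-⋖ 1≤a a≤n 1≤a′ a′≤n (inj₂ (a≢root , a′≢root , same)) b = mk⇔
    (λ a⋖b → subst (_ B.⋖_) (trans (sym same) (sym (A.⋖-is-parent a⋖b))) (B.parent-⋖ 1≤a′ a′≤n a′≢root))
    (λ a′⋖b → subst (_ A.⋖_) (trans same (sym (B.⋖-is-parent a′⋖b))) (A.parent-⋖ 1≤a a≤n a≢root))

  cycle-rotation-cover :
    ∀ {t s} → 1 ≤ t → t < s → s ≤ n → t A.⋖ s → s B.⋖ t → SameParent s t →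
    (∀ {a} → 1 ≤ a → a ≤ n → a ≢ t → a ≢ s → SameParent a a ⊎ (a A.⋖ t × a B.⋖ s)) →
    MTubCover (Cycle n) (GTreeOrder.downSets (toGTree A)) (GTreeOrder.downSets (toGTree B))
  cycle-rotation-cover 1≤t t<s s≤n t⋖s s⋖t s~t others
    with lab-surjective 1≤t (<⇒≤ (<-≤-trans t<s s≤n)) | lab-surjective (≤-trans 1≤t (<⇒≤ t<s)) s≤n
  ... | tᶠ , refl | sᶠ , refl = rotation-cover Cycle-sym ρ t<s
    where
    ρ : IsRotation (toGTree A) (toGTree B) tᶠ sᶠ
    ρ = record
      { t⋖s = t⋖s
      ; s⋖t = s⋖t
      ; parent-swap = λ v → sameParent-⋖ (1≤lab sᶠ) s≤n 1≤t (<⇒≤ (<-≤-trans t<s s≤n)) s~t (lab v)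
      ; others = λ u u≢t u≢s →
          ⊎-map (λ same v → sameParent-⋖ (1≤lab u) (lab≤n u) (1≤lab u) (lab≤n u) same (lab v)) id
                (others (1≤lab u) (lab≤n u) (u≢t ∘ lab-injective) (u≢s ∘ lab-injective))
      }

-- The posets j_{i,k}

small-large-disjoint : ∀ {n i k} → i < n → k ≤ n ∸ i ∸ 1 → ¬ n ∸ i ≤ k
small-large-disjoint {n} {i} i<n k-small k-large =
  <-irrefl refl (≤-<-trans k-large (≤-<-trans k-small (m∸1<m (m<n⇒0<n∸m i<n))))

module SmallK (n i k : ℕ) (1≤i : 1 ≤ i) (1≤k : 1 ≤ k) (i+k<n : i + k < n) where

  i+k+1≡ : i + k + 1 ≡ suc (i + k)
  i+k+1≡ = +-comm (i + k) 1

  i<i+k : i < i + k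
  i<i+k = m<m+n i 1≤k

  i<n : i < n
  i<n = <-trans i<i+k i+k<n

  k-small : k ≤ n ∸ i ∸ 1
  k-small = ∸-monoˡ-≤ 1 (m+n≤o⇒m≤o∸n (suc k) (subst (λ x → suc x ≤ n) (+-comm i k) i+k<n))

  ¬k-large : ¬ n ∸ i ≤ k
  ¬k-large = small-large-disjoint i<n k-small

  _⋖_ : ℕ → ℕ → Set
  _⋖_ = JCov n i k

  parent : ℕ → ℕ
  parent a with a ≟ i
  ... | yes _ = i + k + 1
  ... | no _ with a ≟ i + k
  ...   | yes _ = i
  ...   | no _ = suc a

  parent-i : parent i ≡ i + k + 1
  parent-i with i ≟ i
  ... | yes _ = refl
  ... | no i≢i = ⊥-elim (i≢i refl)

  parent-i+k : parent (i + k) ≡ i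
  parent-i+k with i + k ≟ i
  ... | yes i+k≡i = ⊥-elim (>⇒≢ i<i+k i+k≡i)
  ... | no _ with i + k ≟ i + k
  ...   | yes _ = refl
  ...   | no i+k≢i+k = ⊥-elim (i+k≢i+k refl)

  parent-suc : ∀ {a} → a ≢ i → a ≢ i + k → parent a ≡ suc a
  parent-suc {a} a≢i a≢i+k with a ≟ i
  ... | yes a≡i = ⊥-elim (a≢i a≡i)
  ... | no _ with a ≟ i + k
  ...   | yes a≡i+k = ⊥-elim (a≢i+k a≡i+k)
  ...   | no _ = refl

  -- doubling leaves room to rank i between its child i + k and its parent i + k + 1
  rank : ℕ → ℕ
  rank a with a ≟ i
  ... | yes _ = suc ((i + k) + (i + k))
  ... | no _ = a + a

  rank-i : rank i ≡ suc ((i + k) + (i + k))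
  rank-i with i ≟ i
  ... | yes _ = refl
  ... | no i≢i = ⊥-elim (i≢i refl)

  rank-other : ∀ {a} → a ≢ i → rank a ≡ a + a
  rank-other {a} a≢i with a ≟ i
  ... | yes a≡i = ⊥-elim (a≢i a≡i)
  ... | no _ = refl

  rank-parent : ∀ {a} → a ≢ n → rank a < rank (parent a)
  rank-parent {a} _ with a ≟ i
  ... | yes refl = begin-strict
      suc ((i + k) + (i + k))   <⟨ s≤s (+-monoʳ-< (i + k) ≤-refl) ⟩
      suc (i + k) + suc (i + k) ≡⟨ cong (λ x → x + x) (sym i+k+1≡) ⟩
      (i + k + 1) + (i + k + 1) ≡⟨ sym (rank-other (>⇒≢ (≤-trans i<i+k (m≤m+n (i + k) 1)))) ⟩
      rank (i + k + 1)          ∎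
    where open ≤-Reasoning
  ... | no a≢i with a ≟ i + k
  ...   | yes refl = subst (_ <_) (sym rank-i) ≤-refl
  ...   | no _ with suc a ≟ i
  ...     | yes refl = s≤s (+-mono-≤ a≤i+k a≤i+k)
    where
    a≤i+k : a ≤ i + k
    a≤i+k = ≤-trans (n≤1+n a) (<⇒≤ i<i+k)
  ...     | no _ = +-mono-< ≤-refl ≤-refl

  ⋖-parent : ∀ {a b} → a ⋖ b → a ≢ n × b ≡ parent a × 1 ≤ b × b ≤ n
  ⋖-parent (a1 _) =
    <⇒≢ i<n , sym parent-i , subst (1 ≤_) (sym i+k+1≡) (s≤s z≤n) , subst (_≤ n) (sym i+k+1≡) i+k<n
  ⋖-parent (a2 {a} _ i+k+1≤a a<n) =
    <⇒≢ a<n , sym (parent-suc (>⇒≢ (<-trans i<i+k i+k<a)) (>⇒≢ i+k<a)) , s≤s z≤n , a<n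
    where
    i+k<a : i + k < a
    i+k<a = subst (_≤ a) i+k+1≡ i+k+1≤a
  ⋖-parent (a3 {a} _ i+1≤a a<i+k) =
    <⇒≢ (<-trans a<i+k i+k<n) , sym (parent-suc (>⇒≢ (subst (_≤ a) (+-comm i 1) i+1≤a)) (<⇒≢ a<i+k)) ,
    s≤s z≤n , ≤-trans a<i+k (<⇒≤ i+k<n)
  ⋖-parent (a4 _) = <⇒≢ i+k<n , sym parent-i+k , 1≤i , <⇒≤ i<n
  ⋖-parent (a5 _ _ a<i) =
    <⇒≢ (<-trans a<i i<n) , sym (parent-suc (<⇒≢ a<i) (<⇒≢ (<-trans a<i i<i+k))) ,
    s≤s z≤n , ≤-trans a<i (<⇒≤ i<n)
  ⋖-parent (b1 k-large) = ⊥-elim (¬k-large k-large)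
  ⋖-parent (b2 k-large _ _) = ⊥-elim (¬k-large k-large)
  ⋖-parent (b3 k-large _ _) = ⊥-elim (¬k-large k-large)
  ⋖-parent (b4 k-large _ _) = ⊥-elim (¬k-large k-large)
  ⋖-parent (b5 k-large _) = ⊥-elim (¬k-large k-large)

  parent-⋖ : ∀ {a} → 1 ≤ a → a ≤ n → a ≢ n → a ⋖ parent a
  parent-⋖ {a} 1≤a a≤n a≢n with a ≟ i
  ... | yes refl = a1 k-small
  ... | no a≢i with a ≟ i + k
  ...   | yes refl = a4 k-small
  ...   | no a≢i+k with <-cmp a i
  ...     | tri< a<i _ _ = a5 k-small 1≤a a<i
  ...     | tri≈ _ a≡i _ = ⊥-elim (a≢i a≡i)
  ...     | tri> _ _ i<a with <-cmp a (i + k)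
  ...       | tri< a<i+k _ _ = a3 k-small (subst (_≤ a) (+-comm 1 i) i<a) a<i+k
  ...       | tri≈ _ a≡i+k _ = ⊥-elim (a≢i+k a≡i+k)
  ...       | tri> _ _ i+k<a = a2 k-small (subst (_≤ a) (sym i+k+1≡) i+k<a) (≤∧≢⇒< a≤n a≢n)

  i+1≼i+k : Star _⋖_ (suc i) (i + k)
  i+1≼i+k = ascending-chain (a3 k-small) (≤-reflexive (+-comm i 1)) i<i+k ≤-refl

  suc-comparable : ∀ {a} → 1 ≤ a → suc a ≤ n → Star _⋖_ a (suc a) ⊎ Star _⋖_ (suc a) a
  suc-comparable {a} 1≤a a<n with a ≟ i
  ... | yes refl = inj₂ (i+1≼i+k ◅◅ a4 k-small ◅ ε)
  ... | no a≢i with a ≟ i + k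
  ...   | yes refl = inj₁ (a4 k-small ◅ subst (i ⋖_) i+k+1≡ (a1 k-small) ◅ ε)
  ...   | no a≢i+k =
          inj₁ (subst (a ⋖_) (parent-suc a≢i a≢i+k) (parent-⋖ 1≤a (<⇒≤ a<n) (<⇒≢ a<n)) ◅ ε)

  wrap-comparable : Star _⋖_ 1 n ⊎ Star _⋖_ n 1
  wrap-comparable = inj₁ (ascending-chain (a5 k-small) ≤-refl 1≤i ≤-refl ◅◅ a1 k-small ◅
                          ascending-chain (a2 k-small) ≤-refl (subst (_≤ n) (sym i+k+1≡) i+k<n) ≤-refl)

  subtree-adjacent : ∀ {a} → 1 ≤ a → a ≤ n → a ≢ n →
                     ∃ λ z → 1 ≤ z × z ≤ n × Star _⋖_ z a × CycleAdjacent n z (parent a)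
  subtree-adjacent {a} 1≤a a≤n _ with a ≟ i
  ... | yes refl = i + k , ≤-trans 1≤i (<⇒≤ i<i+k) , <⇒≤ i+k<n , a4 k-small ◅ ε ,
                   inj₁ (subst (CEdge n (i + k)) (sym i+k+1≡) step)
  ... | no a≢i with a ≟ i + k
  ...   | yes refl = suc i , s≤s z≤n , i<n , i+1≼i+k , inj₂ step
  ...   | no _ = a , 1≤a , a≤n , ε , inj₁ step

  tree : CycleTree n
  tree = record
    { _⋖_ = _⋖_
    ; root = n
    ; parent = parent
    ; ⋖-parent = ⋖-parent
    ; parent-⋖ = parent-⋖
    ; rank = rank
    ; rank-parent = rank-parent
    ; suc-comparable = suc-comparable
    ; wrap-comparable = wrap-comparable
    ; subtree-adjacent = subtree-adjacent
    }

module LargeK (n i k : ℕ) (1≤i : 1 ≤ i) (i<n : i < n) (k-large : n ∸ i ≤ k) (k<n : k < n) where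

  m : ℕ
  m = n ∸ k

  1≤m : 1 ≤ m
  1≤m = m<n⇒0<n∸m k<n

  m≤i : m ≤ i
  m≤i = m≤n+o⇒m∸n≤o n k (subst (n ≤_) (+-comm i k) (≤-trans (m≤n+m∸n n i) (+-monoʳ-≤ i k-large)))

  m≤n : m ≤ n
  m≤n = m∸n≤m n k

  ¬k-small : ¬ k ≤ n ∸ i ∸ 1
  ¬k-small k-small = small-large-disjoint i<n k-small k-large

  _⋖_ : ℕ → ℕ → Set
  _⋖_ = JCov n i k

  parent : ℕ → ℕ
  parent a with a ≟ n
  ... | yes _ = m
  ... | no _ with suc a ≟ m
  ...   | yes _ = n
  ...   | no _ = suc a

  parent-n : parent n ≡ m
  parent-n with n ≟ n
  ... | yes _ = refl
  ... | no n≢n = ⊥-elim (n≢n refl)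

  parent-m∸1 : parent (m ∸ 1) ≡ n
  parent-m∸1 with m ∸ 1 ≟ n
  ... | yes m∸1≡n = ⊥-elim (<⇒≢ (<-≤-trans (m∸1<m 1≤m) m≤n) m∸1≡n)
  ... | no _ with suc (m ∸ 1) ≟ m
  ...   | yes _ = refl
  ...   | no ≢m = ⊥-elim (≢m (suc[m∸1]≡m 1≤m))

  parent-suc : ∀ {a} → a ≢ n → suc a ≢ m → parent a ≡ suc a
  parent-suc {a} a≢n sa≢m with a ≟ n
  ... | yes a≡n = ⊥-elim (a≢n a≡n)
  ... | no _ with suc a ≟ m
  ...   | yes sa≡m = ⊥-elim (sa≢m sa≡m)
  ...   | no _ = refl

  -- the chain m ⋖ ⋯ ⋖ i lies above n, so it is shifted by n
  rank : ℕ → ℕ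
  rank a with m ≤? a | a ≤? i
  ... | yes _ | yes _ = a + n
  ... | _ | _ = a

  rank-between : ∀ {a} → m ≤ a → a ≤ i → rank a ≡ a + n
  rank-between {a} m≤a a≤i with m ≤? a | a ≤? i
  ... | yes _ | yes _ = refl
  ... | no m≰a | _ = ⊥-elim (m≰a m≤a)
  ... | yes _ | no a≰i = ⊥-elim (a≰i a≤i)

  rank-outside : ∀ {a} → a < m ⊎ i < a → rank a ≡ a
  rank-outside {a} out with m ≤? a | a ≤? i
  ... | no _ | _ = refl
  ... | yes _ | no _ = refl
  ... | yes m≤a | yes a≤i = ⊥-elim ([ (λ a<m → <⇒≱ a<m m≤a) , (λ i<a → <⇒≱ i<a a≤i) ]′ out)

  rank-suc-outside : ∀ {a} → a < m ⊎ i < a → suc a < m ⊎ i < suc a → rank a < rank (suc a)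
  rank-suc-outside {a} a-out sa-out = subst₂ _<_ (sym (rank-outside a-out)) (sym (rank-outside sa-out)) (n<1+n a)

  rank-suc-between : ∀ {a} → m ≤ a → a < i → rank a < rank (suc a)
  rank-suc-between {a} m≤a a<i =
    subst₂ _<_ (sym (rank-between m≤a (<⇒≤ a<i))) (sym (rank-between (≤-trans m≤a (n≤1+n a)) a<i))
               (n<1+n (a + n))

  rank-suc : ∀ {a} → a ≢ i → suc a ≢ m → rank a < rank (suc a)
  rank-suc {a} a≢i sa≢m with <-cmp a i | <-cmp a m
  ... | tri≈ _ a≡i _ | _ = ⊥-elim (a≢i a≡i)
  ... | tri> _ _ i<a | _ = rank-suc-outside (inj₂ i<a) (inj₂ (<-trans i<a (n<1+n a)))
  ... | tri< _ _ _ | tri< a<m _ _ = rank-suc-outside (inj₁ a<m) (inj₁ (≤∧≢⇒< a<m sa≢m))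
  ... | tri< a<i _ _ | tri≈ _ a≡m _ = rank-suc-between (≤-reflexive (sym a≡m)) a<i
  ... | tri< a<i _ _ | tri> _ _ m<a = rank-suc-between (<⇒≤ m<a) a<i

  rank-parent : ∀ {a} → a ≢ i → rank a < rank (parent a)
  rank-parent {a} a≢i with a ≟ n
  ... | yes refl = subst₂ _<_ (sym (rank-outside (inj₂ i<n))) (sym (rank-between ≤-refl m≤i)) (m<n+m n 1≤m)
  ... | no _ with suc a ≟ m
  ...   | yes sa≡m =
          subst₂ _<_ (sym (rank-outside (inj₁ a<m))) (sym (rank-outside (inj₂ i<n))) (<-≤-trans a<m m≤n)
    where
    a<m : a < m
    a<m = ≤-reflexive sa≡m
  ...   | no sa≢m = rank-suc a≢i sa≢m

  ⋖-parent : ∀ {a b} → a ⋖ b → a ≢ i × b ≡ parent a × 1 ≤ b × b ≤ n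
  ⋖-parent (a1 k-small) = ⊥-elim (¬k-small k-small)
  ⋖-parent (a2 k-small _ _) = ⊥-elim (¬k-small k-small)
  ⋖-parent (a3 k-small _ _) = ⊥-elim (¬k-small k-small)
  ⋖-parent (a4 k-small) = ⊥-elim (¬k-small k-small)
  ⋖-parent (a5 k-small _ _) = ⊥-elim (¬k-small k-small)
  ⋖-parent (b1 _) = >⇒≢ i<n , sym parent-n , 1≤m , m≤n
  ⋖-parent (b2 _ m≤a a<i) =
    <⇒≢ a<i , sym (parent-suc (<⇒≢ (<-trans a<i i<n)) (>⇒≢ (s≤s m≤a))) ,
    s≤s z≤n , ≤-trans a<i (<⇒≤ i<n)
  ⋖-parent (b3 {a} _ i+1≤a a<n) =
    >⇒≢ i<a , sym (parent-suc (<⇒≢ a<n) (>⇒≢ (s≤s (≤-trans m≤i (<⇒≤ i<a))))) , s≤s z≤n , a<n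
    where
    i<a : i < a
    i<a = subst (_≤ a) (+-comm i 1) i+1≤a
  ⋖-parent (b4 {a} _ _ a<m∸1) =
    <⇒≢ (<-≤-trans a<m m≤i) , sym (parent-suc (<⇒≢ (<-≤-trans a<m m≤n)) (<⇒≢ sa<m)) ,
    s≤s z≤n , ≤-trans (<⇒≤ sa<m) m≤n
    where
    sa<m : suc a < m
    sa<m = ≤-<-trans a<m∸1 (m∸1<m 1≤m)
    a<m : a < m
    a<m = <-trans (n<1+n a) sa<m
  ⋖-parent (b5 _ _) =
    <⇒≢ (<-≤-trans (m∸1<m 1≤m) m≤i) , sym parent-m∸1 , ≤-trans 1≤i (<⇒≤ i<n) , ≤-refl

  m∸1⋖n : ∀ {a} → 1 ≤ a → suc a ≡ m → a ⋖ n
  m∸1⋖n 1≤a sa≡m =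
    subst (_⋖ n) (cong (_∸ 1) (sym sa≡m)) (b5 k-large (subst (1 ≤_) (cong (_∸ 1) sa≡m) 1≤a))

  parent-⋖ : ∀ {a} → 1 ≤ a → a ≤ n → a ≢ i → a ⋖ parent a
  parent-⋖ {a} 1≤a a≤n a≢i with a ≟ n
  ... | yes refl = b1 k-large
  ... | no a≢n with suc a ≟ m
  ...   | yes sa≡m = m∸1⋖n 1≤a sa≡m
  ...   | no sa≢m with <-cmp a m | <-cmp a i
  ...     | tri< a<m _ _ | _ = b4 k-large 1≤a (∸-monoˡ-≤ 1 (≤∧≢⇒< a<m sa≢m))
  ...     | tri≈ _ a≡m _ | tri< a<i _ _ = b2 k-large (≤-reflexive (sym a≡m)) a<i
  ...     | tri> _ _ m<a | tri< a<i _ _ = b2 k-large (<⇒≤ m<a) a<i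
  ...     | _ | tri≈ _ a≡i _ = ⊥-elim (a≢i a≡i)
  ...     | _ | tri> _ _ i<a = b3 k-large (subst (_≤ a) (+-comm 1 i) i<a) (≤∧≢⇒< a≤n a≢n)

  1≤m∸1 : m ≢ 1 → 1 ≤ m ∸ 1
  1≤m∸1 m≢1 = ∸-monoˡ-≤ 1 (≤∧≢⇒< 1≤m (m≢1 ∘ sym))

  1≼below-m : ∀ {a} → 1 ≤ a → a ≤ m ∸ 1 → Star _⋖_ 1 a
  1≼below-m = ascending-chain (b4 k-large) ≤-refl

  suc-comparable : ∀ {a} → 1 ≤ a → suc a ≤ n → Star _⋖_ a (suc a) ⊎ Star _⋖_ (suc a) a
  suc-comparable {a} 1≤a a<n with a ≟ i
  ... | yes refl = inj₂ (ascending-chain (b3 k-large) (≤-reflexive (+-comm i 1)) a<n ≤-refl ◅◅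
                         b1 k-large ◅ ascending-chain (b2 k-large) ≤-refl m≤i ≤-refl)
  ... | no a≢i with suc a ≟ m
  ...   | yes sa≡m = inj₁ (m∸1⋖n 1≤a sa≡m ◅ subst (n ⋖_) (sym sa≡m) (b1 k-large) ◅ ε)
  ...   | no sa≢m = inj₁ (subst (a ⋖_) (parent-suc (<⇒≢ a<n) sa≢m) (parent-⋖ 1≤a (<⇒≤ a<n) a≢i) ◅ ε)

  wrap-comparable : Star _⋖_ 1 n ⊎ Star _⋖_ n 1
  wrap-comparable with m ≟ 1
  ... | yes m≡1 = inj₂ (subst (n ⋖_) m≡1 (b1 k-large) ◅ ε)
  ... | no m≢1 = inj₁ (1≼below-m (1≤m∸1 m≢1) ≤-refl ◅◅ b5 k-large (1≤m∸1 m≢1) ◅ ε)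

  subtree-adjacent : ∀ {a} → 1 ≤ a → a ≤ n → a ≢ i →
                     ∃ λ z → 1 ≤ z × z ≤ n × Star _⋖_ z a × CycleAdjacent n z (parent a)
  subtree-adjacent {a} 1≤a a≤n _ with a ≟ n
  ... | yes refl with m ≟ 1
  ...   | yes m≡1 = n , ≤-trans 1≤i (<⇒≤ i<n) , ≤-refl , ε , inj₁ (subst (CEdge n n) (sym m≡1) wrap)
  ...   | no m≢1 = m ∸ 1 , 1≤m∸1 m≢1 , ≤-trans (<⇒≤ (m∸1<m 1≤m)) m≤n , b5 k-large (1≤m∸1 m≢1) ◅ ε ,
                   inj₁ (subst (CEdge n (m ∸ 1)) (suc[m∸1]≡m 1≤m) step)
  subtree-adjacent {a} 1≤a a≤n _ | no _ with suc a ≟ m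
  ...   | yes sa≡m =
          1 , ≤-refl , ≤-trans 1≤i (<⇒≤ i<n) , 1≼below-m 1≤a (≤-reflexive (cong (_∸ 1) sa≡m)) , inj₂ wrap
  ...   | no _ = a , 1≤a , a≤n , ε , inj₁ step

  tree : CycleTree n
  tree = record
    { _⋖_ = _⋖_
    ; root = i
    ; parent = parent
    ; ⋖-parent = ⋖-parent
    ; parent-⋖ = parent-⋖
    ; rank = rank
    ; rank-parent = rank-parent
    ; suc-comparable = suc-comparable
    ; wrap-comparable = wrap-comparable
    ; subtree-adjacent = subtree-adjacent
    }

small→small : ∀ {n i k} → 1 ≤ i → 1 ≤ k → i + suc k < n →
              MTubCover (Cycle n) (𝒥 n i k) (𝒥 n i (suc k))
small→small {n} {i} {k} 1≤i 1≤k i+k+1<n =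
  cycle-rotation-cover A.tree B.tree 1≤i i<s (<⇒≤ s<n) (a1 A.k-small) s⋖i s~i others
  where
  module A = SmallK n i k 1≤i 1≤k (<-trans (+-monoʳ-< i ≤-refl) i+k+1<n)
  module B = SmallK n i (suc k) 1≤i (s≤s z≤n) i+k+1<n
  s : ℕ
  s = i + k + 1
  s≡ : i + suc k ≡ s
  s≡ = trans (+-suc i k) (sym A.i+k+1≡)
  s<n : s < n
  s<n = subst (_< n) s≡ i+k+1<n
  i+k<s : i + k < s
  i+k<s = subst (i + k <_) (sym A.i+k+1≡) ≤-refl
  i<s : i < s
  i<s = <-trans A.i<i+k i+k<s
  s⋖i : B._⋖_ s i
  s⋖i = subst (B._⋖ i) s≡ (a4 B.k-small)
  s~i : SameParent A.tree B.tree s i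
  s~i = inj₂ (<⇒≢ s<n , <⇒≢ A.i<n , (begin
    A.parent s     ≡⟨ A.parent-suc (>⇒≢ i<s) (>⇒≢ i+k<s) ⟩
    suc s          ≡⟨ +-comm 1 s ⟩
    s + 1          ≡⟨ cong (_+ 1) (sym s≡) ⟩
    i + suc k + 1  ≡⟨ sym B.parent-i ⟩
    B.parent i     ∎))
    where open ≡-Reasoning
  others : ∀ {a} → 1 ≤ a → a ≤ n → a ≢ i → a ≢ s →
           SameParent A.tree B.tree a a ⊎ (A._⋖_ a i × B._⋖_ a s)
  others {a} _ _ a≢i a≢s with a ≟ n | a ≟ i + k
  ... | yes a≡n | _ = inj₁ (inj₁ (a≡n , a≡n))
  ... | no _ | yes refl =
        inj₂ (a4 A.k-small , subst (B._⋖_ (i + k)) (sym A.i+k+1≡)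
                                   (a3 B.k-small (subst (_≤ i + k) (+-comm 1 i) A.i<i+k) (≤-reflexive (sym (+-suc i k)))))
  ... | no a≢n | no a≢i+k =
        inj₁ (inj₂ (a≢n , a≢n , trans (A.parent-suc a≢i a≢i+k)
                                      (sym (B.parent-suc a≢i (λ a≡ → a≢s (trans a≡ s≡))))))

small→large : ∀ {n i k} → 1 ≤ i → 1 ≤ k → i + suc k ≡ n →
              MTubCover (Cycle n) (𝒥 n i k) (𝒥 n i (suc k))
small→large {n} {i} {k} 1≤i 1≤k i+k+1≡n =
  cycle-rotation-cover A.tree B.tree 1≤i A.i<n ≤-refl i⋖n n⋖i (inj₁ (refl , refl)) others
  where
  module A = SmallK n i k 1≤i 1≤k (subst (i + k <_) i+k+1≡n (+-monoʳ-< i ≤-refl))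
  k+1-large : n ∸ i ≤ suc k
  k+1-large = m≤n+o⇒m∸n≤o n i (≤-reflexive (sym i+k+1≡n))
  module B = LargeK n i (suc k) 1≤i A.i<n k+1-large (subst (suc k <_) i+k+1≡n (m<n+m (suc k) 1≤i))
  suc[i+k]≡n : suc (i + k) ≡ n
  suc[i+k]≡n = trans (sym (+-suc i k)) i+k+1≡n
  m≡i : B.m ≡ i
  m≡i = trans (cong (_∸ suc k) (sym i+k+1≡n)) (m+n∸n≡m i (suc k))
  i⋖n : A._⋖_ i n
  i⋖n = subst (A._⋖_ i) (trans A.i+k+1≡ suc[i+k]≡n) (a1 A.k-small)
  n⋖i : B._⋖_ n i
  n⋖i = subst (B._⋖_ n) m≡i (b1 k+1-large)
  others : ∀ {a} → 1 ≤ a → a ≤ n → a ≢ i → a ≢ n →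
           SameParent A.tree B.tree a a ⊎ (A._⋖_ a i × B._⋖_ a n)
  others {a} 1≤a _ a≢i a≢n with a ≟ i + k | suc a ≟ i
  ... | yes refl | _ =
        inj₂ (a4 A.k-small , subst (B._⋖_ (i + k)) suc[i+k]≡n
                                   (b3 k+1-large (subst (_≤ i + k) (+-comm 1 i) A.i<i+k) (≤-reflexive suc[i+k]≡n)))
  ... | no _ | yes sa≡i =
        inj₂ (subst (A._⋖_ a) sa≡i (a5 A.k-small 1≤a (≤-reflexive sa≡i)) , B.m∸1⋖n 1≤a (trans sa≡i (sym m≡i)))
  ... | no a≢i+k | no sa≢i =
        inj₁ (inj₂ (a≢n , a≢i , trans (A.parent-suc a≢i a≢i+k)
                      (sym (B.parent-suc a≢n (λ sa≡ → sa≢i (trans sa≡ m≡i))))))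

large→large : ∀ {n i k} → 1 ≤ i → i < n → n ∸ i ≤ k → suc k < n →
              MTubCover (Cycle n) (𝒥 n i k) (𝒥 n i (suc k))
large→large {n} {i} {k} 1≤i i<n k-large k+1<n =
  cycle-rotation-cover A.tree B.tree 1≤t t<n ≤-refl (b5 k-large 1≤t) n⋖t n~t others
  where
  module A = LargeK n i k 1≤i i<n k-large (<-trans ≤-refl k+1<n)
  k+1-large : n ∸ i ≤ suc k
  k+1-large = ≤-trans k-large (n≤1+n k)
  module B = LargeK n i (suc k) 1≤i i<n k+1-large k+1<n
  t : ℕ
  t = A.m ∸ 1
  1≤t : 1 ≤ t
  1≤t = ∸-monoˡ-≤ 1 (m+n≤o⇒m≤o∸n 2 k+1<n)
  t<m : t < A.m
  t<m = m∸1<m A.1≤m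
  t<n : t < n
  t<n = <-≤-trans t<m A.m≤n
  Bm≡t : B.m ≡ t
  Bm≡t = sym (trans (∸-+-assoc n k 1) (cong (n ∸_) (+-comm k 1)))
  n⋖t : B._⋖_ n t
  n⋖t = subst (B._⋖_ n) Bm≡t (b1 k+1-large)
  n~t : SameParent A.tree B.tree n t
  n~t = inj₂ (>⇒≢ i<n , <⇒≢ (<-≤-trans t<m A.m≤i) , (begin
    A.parent n  ≡⟨ A.parent-n ⟩
    A.m         ≡⟨ sym (suc[m∸1]≡m A.1≤m) ⟩
    suc t       ≡⟨ sym (B.parent-suc (<⇒≢ t<n) (λ st≡Bm → 1+n≢n (trans st≡Bm Bm≡t))) ⟩
    B.parent t  ∎))
    where open ≡-Reasoning
  others : ∀ {a} → 1 ≤ a → a ≤ n → a ≢ t → a ≢ n →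
           SameParent A.tree B.tree a a ⊎ (A._⋖_ a t × B._⋖_ a n)
  others {a} 1≤a a≤n a≢t a≢n with a ≟ i | suc a ≟ B.m
  ... | yes a≡i | _ = inj₁ (inj₁ (a≡i , a≡i))
  ... | no a≢i | yes sa≡Bm =
        inj₂ (subst (A._⋖_ a) (trans (A.parent-suc a≢n sa≢Am) (trans sa≡Bm Bm≡t)) (A.parent-⋖ 1≤a a≤n a≢i) ,
              B.m∸1⋖n 1≤a sa≡Bm)
    where
    sa≢Am : suc a ≢ A.m
    sa≢Am sa≡Am = <-irrefl (trans (sym (trans sa≡Bm Bm≡t)) sa≡Am) t<m
  ... | no a≢i | no sa≢Bm =
        inj₁ (inj₂ (a≢i , a≢i , trans (A.parent-suc a≢n sa≢Am) (sym (B.parent-suc a≢n sa≢Bm))))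
    where
    sa≢Am : suc a ≢ A.m
    sa≢Am sa≡Am = a≢t (cong (_∸ 1) sa≡Am)

proposition9p2 : ∀ (n : ℕ) → 3 ≤ n → ∀ (i : ℕ) → 1 ≤ i → i ≤ n ∸ 1 →
                   ∀ (k : ℕ) → 1 ≤ k → suc k ≤ n ∸ 1 →
                   MTubCover (Cycle n) (𝒥 n i k) (𝒥 n i (suc k))
proposition9p2 n 3≤n i 1≤i i≤n∸1 k 1≤k k+1≤n∸1 with <-cmp (i + suc k) n
... | tri< i+k+1<n _ _ = small→small 1≤i 1≤k i+k+1<n
... | tri≈ _ i+k+1≡n _ = small→large 1≤i 1≤k i+k+1≡n
... | tri> _ _ n<i+k+1 = large→large 1≤i (≤n∸1⇒<n i≤n∸1) k-large (≤n∸1⇒<n k+1≤n∸1)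
  where
  ≤n∸1⇒<n : ∀ {x} → x ≤ n ∸ 1 → x < n
  ≤n∸1⇒<n x≤n∸1 = ≤-<-trans x≤n∸1 (m∸1<m (≤-trans (s≤s z≤n) 3≤n))
  k-large : n ∸ i ≤ k
  k-large = m≤n+o⇒m∸n≤o n i (≤-pred (subst (n <_) (+-suc i k) n<i+k+1))
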